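{- There is a register machine (addition machine) with four integer registers which, on input of two integers $x$ and $y$, outputs $x\cdot y$ and whose number of executed steps is $O(n)$, where $n$ is the number of binary digits of the smaller of $|x|,|y|$. In particular, squaring a number $x$ can be done by a register machine with four registers in time proportional to $\log(|x|)$ for $|x|\geq 2$.
   Context: Model (addition machine): a program is a finite list of numbered lines; the machine has finitely many registers, each holding an arbitrary integer. Allowed commands, each counting as one step, are: $x=y+z$, $x=y+k$, $x=y-z$, $x=y-k$, $x=k-y$, $x=k$ (for registers $x,y,z$, not necessarily distinct, and integer constants $k$); "read $x$" (reads one whole integer input into a register) and "write $x$" (outputs the whole content of a register); "if $x\,R\,y$ then ... else ..." and "if $x\,R\,k$ then ... else ..." with $R\in\{<,=,>,\neq,\leq,\geq\}$; and "goto $\ell$" for a fixed line number $\ell$. In addition the program may use finitely many variables with a fixed finite range of values; these do not count as registers (they can be eliminated by making finitely many copies of the program). The number of registers of a machine is the number of integer registers it uses. The size of an integer $x$ is its number of binary digits, i.e. the least $n\geq 1$ with $-2^n<x<2^n$; running time is the number of executed commands. -}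

module Defs where

open import Data.Nat as ℕ using (ℕ; zero; suc; _^_; _≤_; _<_; _⊔_; _⊓_)
open import Data.Integer as ℤ using (ℤ; +_; ∣_∣)
open import Data.Fin as Fin using (Fin)
open import Data.Bool using (Bool; true; false; if_then_else_; not)
open import Data.List using (List; []; _∷_; _++_; [_])
open import Data.Maybe using (Maybe; just; nothing)
open import Data.Product using (_×_; _,_)
open import Relation.Nullary.Decidable using (⌊_⌋)
open import Relation.Binary.PropositionalEquality using (_≡_)

-- Execution starts at line 0
-- with all registers 0, and the machine halts when the program counter
-- does not point to an existing line.

data Rel : Set where
  lt eq gt ne le ge : Rel

holds : Rel → ℤ → ℤ → Bool
holds lt a b = ⌊ a ℤ.<? b ⌋
holds eq a b = ⌊ a ℤ.≟ b ⌋
holds gt a b = ⌊ b ℤ.<? a ⌋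
holds ne a b = not ⌊ a ℤ.≟ b ⌋
holds le a b = ⌊ a ℤ.≤? b ⌋
holds ge a b = ⌊ b ℤ.≤? a ⌋

data Instr (r : ℕ) : Set where
  add    : (x y z : Fin r) → Instr r
  addK   : (x y : Fin r) → ℤ → Instr r
  sub    : (x y z : Fin r) → Instr r
  subK   : (x y : Fin r) → ℤ → Instr r
  kSub   : (x y : Fin r) → ℤ → Instr r
  const  : (x : Fin r) → ℤ → Instr r
  read   : (x : Fin r) → Instr r
  write  : (x : Fin r) → Instr r
  ifReg  : Rel → (x y : Fin r) → (ℓ₁ ℓ₂ : ℕ) → Instr r
  ifK    : Rel → (x : Fin r) → ℤ → (ℓ₁ ℓ₂ : ℕ) → Instr r
  goto   : ℕ → Instr r

Program : ℕ → Set
Program r = List (Instr r)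

fetch : ∀ {A : Set} → List A → ℕ → Maybe A
fetch []       _       = nothing
fetch (a ∷ _)  zero    = just a
fetch (_ ∷ as) (suc n) = fetch as n

Regs : ℕ → Set
Regs r = Fin r → ℤ

update : ∀ {r} → Regs r → Fin r → ℤ → Regs r
update ρ i v j = if ⌊ j Fin.≟ i ⌋ then v else ρ j

record Config (r : ℕ) : Set where
  constructor config
  field
    pc     : ℕ
    regs   : Regs r
    input  : List ℤ
    output : List ℤ

open Config public

-- One execution step of an instruction.  Reading from an exhausted
-- input blocks the machine (no step possible).
exec : ∀ {r} → Instr r → Config r → Maybe (Config r)
exec (add x y z)  (config p ρ i o) = just (config (suc p) (update ρ x (ρ y ℤ.+ ρ z)) i o)
exec (addK x y k) (config p ρ i o) = just (config (suc p) (update ρ x (ρ y ℤ.+ k)) i o)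
exec (sub x y z)  (config p ρ i o) = just (config (suc p) (update ρ x (ρ y ℤ.- ρ z)) i o)
exec (subK x y k) (config p ρ i o) = just (config (suc p) (update ρ x (ρ y ℤ.- k)) i o)
exec (kSub x y k) (config p ρ i o) = just (config (suc p) (update ρ x (k ℤ.- ρ y)) i o)
exec (const x k)  (config p ρ i o) = just (config (suc p) (update ρ x k) i o)
exec (read x)     (config p ρ [] o)      = nothing
exec (read x)     (config p ρ (v ∷ i) o) = just (config (suc p) (update ρ x v) i o)
exec (write x)    (config p ρ i o) = just (config (suc p) ρ i (o ++ [ ρ x ]))
exec (ifReg R x y ℓ₁ ℓ₂) (config p ρ i o) =
  just (config (if holds R (ρ x) (ρ y) then ℓ₁ else ℓ₂) ρ i o)
exec (ifK R x k ℓ₁ ℓ₂) (config p ρ i o) =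
  just (config (if holds R (ρ x) k then ℓ₁ else ℓ₂) ρ i o)
exec (goto ℓ)     (config p ρ i o) = just (config ℓ ρ i o)

data Step {r} (P : Program r) : Config r → Config r → Set where
  step : ∀ {c c' ins} → fetch P (pc c) ≡ just ins → exec ins c ≡ just c' → Step P c c'

data Steps {r} (P : Program r) : ℕ → Config r → Config r → Set where
  done : ∀ {c} → Steps P zero c c
  more : ∀ {t c c' c''} → Step P c c' → Steps P t c' c'' → Steps P (suc t) c c''

Halted : ∀ {r} → Program r → Config r → Set
Halted P c = fetch P (pc c) ≡ nothing

initial : ∀ {r} → List ℤ → Config r
initial inp = config zero (λ _ → + 0) inp []

RunsTo : ∀ {r} → Program r → List ℤ → List ℤ → ℕ → Set
RunsTo P inp out t = ∃Final
  where
  open import Data.Product using (∃)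
  ∃Final = ∃ λ c → Steps P t (initial inp) c × Halted P c × output c ≡ out

-- Size of an integer: least n ≥ 1 with -2^n < x < 2^n (stated for |x|).
IsSize : ℕ → ℕ → Set
IsSize m n = (1 ≤ n) × (m < 2 ^ n) × (∀ k → 1 ≤ k → m < 2 ^ k → n ≤ k)

{-# OPTIONS --safe #-}
-- Let a be the factor of smaller absolute value, of size n, and b the other
-- one; after a change of sign a ≥ 0.  Put a sentinel bit below a, A := 2a + 1,
-- and double C from 1 until C = 2^k > A, which takes k ≤ n + 1 rounds.  Then
-- double A repeatedly: comparing A with C reveals the leading unread bit of a,
-- which is removed again by A := A − C when it is 1, while Horner's rule
-- D := 2D + bit·b accumulates a·b; when only the sentinel is left, A = C.
-- Every round of both loops takes a bounded number of steps.
module Submission where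

open import Defs
open import Data.Nat using (ℕ; _*_; _≤_; _⊓_; _<_)
open import Data.Nat.Logarithm using (⌊log₂_⌋; ⌊log₂⌋-mono-≤; ⌊log₂[2^n]⌋≡n)
open import Data.Integer as ℤ using (ℤ; ∣_∣)
open import Data.List using (List; []; _∷_; [_])
open import Data.Product using (Σ; ∃; _×_; _,_)

open import Data.Bool using (true; false; not; if_then_else_)
open import Data.Empty using (⊥-elim)
open import Function using (_∘_)
open import Data.Fin as Fin using (Fin)
open import Data.Integer using (+_; -[1+_])
import Data.Integer.Properties as ℤₚ
import Data.Integer.Tactic.RingSolver as ℤ-Ring
open import Data.Maybe using (just)
open import Data.Nat as ℕ using (zero; suc; _+_; _^_; _∸_; z≤n; s≤s)
import Data.Nat.Properties as ℕₚ
import Data.Nat.Tactic.RingSolver as ℕ-Ring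
open import Data.Sum using (_⊎_; inj₁; inj₂)
open import Relation.Binary.PropositionalEquality
  using (_≡_; refl; sym; trans; cong; cong₂; subst; subst₂)
open import Relation.Nullary using (¬_; Dec; yes; no)
open import Relation.Nullary.Decidable using (isYes; isYes≗does; dec-true; dec-false)

⟦_⟧ : Rel → ℤ → ℤ → Set
⟦ lt ⟧ a b = a ℤ.< b
⟦ eq ⟧ a b = a ≡ b
⟦ gt ⟧ a b = b ℤ.< a
⟦ ne ⟧ a b = ¬ a ≡ b
⟦ le ⟧ a b = a ℤ.≤ b
⟦ ge ⟧ a b = b ℤ.≤ a

isYes-true : ∀ {A : Set} (a? : Dec A) → A → isYes a? ≡ true
isYes-true a? a = trans (isYes≗does a?) (dec-true a? a)

isYes-false : ∀ {A : Set} (a? : Dec A) → ¬ A → isYes a? ≡ false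
isYes-false a? ¬a = trans (isYes≗does a?) (dec-false a? ¬a)

holds-true : ∀ R {a b} → ⟦ R ⟧ a b → holds R a b ≡ true
holds-true lt {a} {b} p = isYes-true (a ℤ.<? b) p
holds-true eq {a} {b} p = isYes-true (a ℤ.≟ b) p
holds-true gt {a} {b} p = isYes-true (b ℤ.<? a) p
holds-true ne {a} {b} p = cong not (isYes-false (a ℤ.≟ b) p)
holds-true le {a} {b} p = isYes-true (a ℤ.≤? b) p
holds-true ge {a} {b} p = isYes-true (b ℤ.≤? a) p

holds-false : ∀ R {a b} → ¬ ⟦ R ⟧ a b → holds R a b ≡ false
holds-false lt {a} {b} p = isYes-false (a ℤ.<? b) p
holds-false eq {a} {b} p = isYes-false (a ℤ.≟ b) p
holds-false gt {a} {b} p = isYes-false (b ℤ.<? a) p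
holds-false ne {a} {b} p with a ℤ.≟ b
... | yes _   = refl
... | no  a≢b = ⊥-elim (p a≢b)
holds-false le {a} {b} p = isYes-false (a ℤ.≤? b) p
holds-false ge {a} {b} p = isYes-false (b ℤ.≤? a) p

update-same : ∀ {r} (ρ : Regs r) X v → update ρ X v X ≡ v
update-same ρ X v rewrite isYes-true (X Fin.≟ X) refl = refl

update-other : ∀ {r} (ρ : Regs r) X v j → ¬ j ≡ X → update ρ X v j ≡ ρ j
update-other ρ X v j j≢X rewrite isYes-false (j Fin.≟ X) j≢X = refl

module Execution {r} (P : Program r) where

  HaltsWithin : Config r → ℕ → List ℤ → Set
  HaltsWithin c B out =
    ∃ λ t → t ≤ B × ∃ λ c' → Steps P t c c' × Halted P c' × output c' ≡ out

  halts : ∀ {c out} → Halted P c → output c ≡ out → HaltsWithin c 0 out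
  halts h o = 0 , z≤n , _ , done , h , o

  step-then : ∀ {c c' B out} → Step P c c' → HaltsWithin c' B out → HaltsWithin c (suc B) out
  step-then s (t , t≤B , c'' , run , h , o) = suc t , s≤s t≤B , c'' , more s run , h , o

  steps-then : ∀ {t c c' B out} → Steps P t c c' → HaltsWithin c' B out → HaltsWithin c (t + B) out
  steps-then done         h = h
  steps-then (more s run) h = step-then s (steps-then run h)

  HaltsWithin-mono : ∀ {c B B' out} → B ≤ B' → HaltsWithin c B out → HaltsWithin c B' out
  HaltsWithin-mono B≤B' (t , t≤B , rest) = t , ℕₚ.≤-trans t≤B B≤B' , rest

  module _ {p ℓ₁ ℓ₂ : ℕ} {ρ : Regs r} {i o : List ℤ} {R : Rel} {u w : ℤ} where

    ifReg-taken : ∀ {x y} → fetch P p ≡ just (ifReg R x y ℓ₁ ℓ₂) → ρ x ≡ u → ρ y ≡ w →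
                  ⟦ R ⟧ u w → Step P (config p ρ i o) (config ℓ₁ ρ i o)
    ifReg-taken f refl refl h =
      step f (cong (λ b → just (config (if b then ℓ₁ else ℓ₂) ρ i o)) (holds-true R h))

    ifReg-skipped : ∀ {x y} → fetch P p ≡ just (ifReg R x y ℓ₁ ℓ₂) → ρ x ≡ u → ρ y ≡ w →
                    ¬ ⟦ R ⟧ u w → Step P (config p ρ i o) (config ℓ₂ ρ i o)
    ifReg-skipped f refl refl h =
      step f (cong (λ b → just (config (if b then ℓ₁ else ℓ₂) ρ i o)) (holds-false R h))

    ifK-taken : ∀ {x} → fetch P p ≡ just (ifK R x w ℓ₁ ℓ₂) → ρ x ≡ u →
                ⟦ R ⟧ u w → Step P (config p ρ i o) (config ℓ₁ ρ i o)
    ifK-taken f refl h =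
      step f (cong (λ b → just (config (if b then ℓ₁ else ℓ₂) ρ i o)) (holds-true R h))

    ifK-skipped : ∀ {x} → fetch P p ≡ just (ifK R x w ℓ₁ ℓ₂) → ρ x ≡ u →
                  ¬ ⟦ R ⟧ u w → Step P (config p ρ i o) (config ℓ₂ ρ i o)
    ifK-skipped f refl h =
      step f (cong (λ b → just (config (if b then ℓ₁ else ℓ₂) ρ i o)) (holds-false R h))

  absolute-value : ∀ {ℓ X i o B out} →
    fetch P ℓ ≡ just (ifK ge X (+ 0) (2 + ℓ) (1 + ℓ)) → fetch P (1 + ℓ) ≡ just (kSub X X (+ 0)) →
    ∀ z ρ → ρ X ≡ z →
    (∀ ρ' → ρ' X ≡ + ∣ z ∣ → (∀ j → ¬ j ≡ X → ρ' j ≡ ρ j) → HaltsWithin (config (2 + ℓ) ρ' i o) B out) →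
    HaltsWithin (config ℓ ρ i o) (2 + B) out
  absolute-value test negate (+ n) ρ ρX≡z k =
    HaltsWithin-mono (ℕₚ.n≤1+n _)
      (step-then (ifK-taken test ρX≡z (ℤ.+≤+ z≤n)) (k ρ ρX≡z (λ _ _ → refl)))
  absolute-value test negate -[1+ n ] ρ ρX≡z k =
    step-then (ifK-skipped test ρX≡z λ ()) (step-then (step negate refl)
      (k _ (trans (update-same ρ _ _) (cong (λ v → + 0 ℤ.- v) ρX≡z)) (update-other ρ _ _)))

m<n⇒1+2m<2n : ∀ {m n} → m < n → 1 + 2 * m < 2 * n
m<n⇒1+2m<2n {m} {n} m<n = subst (_≤ 2 * n) (two-suc m) (ℕₚ.*-monoʳ-≤ 2 m<n)
  where
  two-suc : ∀ m → 2 * suc m ≡ suc (1 + 2 * m)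
  two-suc = ℕ-Ring.solve-∀

1+2m<2n⇒m<n : ∀ {m n} → 1 + 2 * m < 2 * n → m < n
1+2m<2n⇒m<n {m} {n} 1+2m<2n = ℕₚ.*-cancelˡ-< 2 m n (ℕₚ.<-trans (ℕₚ.n<1+n (2 * m)) 1+2m<2n)

leadingBit : ∀ M c → c < 2 * M → c < M ⊎ ∃ λ c' → c ≡ M + c' × c' < M
leadingBit M c c<2M with c ℕₚ.<? M
... | yes c<M = inj₁ c<M
... | no  c≮M = inj₂ (c ∸ M , sym (ℕₚ.m+[n∸m]≡n M≤c) ,
                      ℕₚ.+-cancelˡ-< M (c ∸ M) M (subst₂ _<_ (sym (ℕₚ.m+[n∸m]≡n M≤c)) M+M c<2M))
  where
  M≤c : M ≤ c
  M≤c = ℕₚ.≮⇒≥ c≮M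
  M+M : 2 * M ≡ M + M
  M+M = cong (λ k → M + k) (ℕₚ.+-identityʳ M)

affine≤linear : ∀ a b n .{{_ : ℕ.NonZero n}} → b + n * a ≤ (a + b) * n
affine≤linear a b n = begin
  b + n * a      ≤⟨ ℕₚ.+-monoˡ-≤ (n * a) (ℕₚ.m≤m*n b n) ⟩
  b * n + n * a  ≡⟨ regroup a b n ⟩
  (a + b) * n    ∎
  where
  open ℕₚ.≤-Reasoning
  regroup : ∀ a b n → b * n + n * a ≡ (a + b) * n
  regroup = ℕ-Ring.solve-∀

n<2^[1+⌊log₂n⌋] : ∀ n → n < 2 ^ suc ⌊log₂ n ⌋
n<2^[1+⌊log₂n⌋] n = ℕₚ.≰⇒> λ 2^[1+log]≤n → ℕₚ.<-irrefl refl
  (subst (_≤ ⌊log₂ n ⌋) (⌊log₂[2^n]⌋≡n (suc ⌊log₂ n ⌋)) (⌊log₂⌋-mono-≤ 2^[1+log]≤n))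

2≤n⇒1≤⌊log₂n⌋ : ∀ {n} → 2 ≤ n → 1 ≤ ⌊log₂ n ⌋
2≤n⇒1≤⌊log₂n⌋ {n} 2≤n = subst (_≤ ⌊log₂ n ⌋) (⌊log₂[2^n]⌋≡n 1) (⌊log₂⌋-mono-≤ 2≤n)

horner-0 : ∀ r b M c → (r ℤ.+ r) ℤ.* + M ℤ.+ c ℤ.* b ≡ r ℤ.* + (2 * M) ℤ.+ c ℤ.* b
horner-0 r b M c = trans (ring r b (+ M) c) (cong (λ M' → r ℤ.* M' ℤ.+ c ℤ.* b) (sym (ℤₚ.pos-* 2 M)))
  where
  ring : ∀ r b M c → (r ℤ.+ r) ℤ.* M ℤ.+ c ℤ.* b ≡ r ℤ.* (+ 2 ℤ.* M) ℤ.+ c ℤ.* b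
  ring = ℤ-Ring.solve-∀

horner-1 : ∀ r b M c → (r ℤ.+ r ℤ.+ b) ℤ.* + M ℤ.+ c ℤ.* b ≡ r ℤ.* + (2 * M) ℤ.+ (+ M ℤ.+ c) ℤ.* b
horner-1 r b M c = trans (ring r b (+ M) c) (cong (λ M' → r ℤ.* M' ℤ.+ (+ M ℤ.+ c) ℤ.* b) (sym (ℤₚ.pos-* 2 M)))
  where
  ring : ∀ r b M c → (r ℤ.+ r ℤ.+ b) ℤ.* M ℤ.+ c ℤ.* b ≡ r ℤ.* (+ 2 ℤ.* M) ℤ.+ (M ℤ.+ c) ℤ.* b
  ring = ℤ-Ring.solve-∀

rA rB rC rD : Fin 4
rA = Fin.zero
rB = Fin.suc Fin.zero
rC = Fin.suc (Fin.suc Fin.zero)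
rD = Fin.suc (Fin.suc (Fin.suc Fin.zero))

-- Lines 0–1 load the factors into A and B (the squaring program copies A
-- instead of reading B).  Lines 2–11 put |A|, |B| into C, D and swap A and B
-- unless |A| ≤ |B|, lines 12–14 negate both if A < 0, lines 15–20 set
-- A := 2A + 1 and double C from 1 until C > A, and lines 21–29 read the bits
-- of A from the top into D.
multiplier : Instr 4 → Instr 4 → Program 4
multiplier load₁ load₂ =
  load₁ ∷
  load₂ ∷
  addK rC rA (+ 0) ∷
  ifK ge rC (+ 0) 5 4 ∷
  kSub rC rC (+ 0) ∷
  addK rD rB (+ 0) ∷
  ifK ge rD (+ 0) 8 7 ∷
  kSub rD rD (+ 0) ∷
  ifReg le rC rD 12 9 ∷
  addK rC rA (+ 0) ∷
  addK rA rB (+ 0) ∷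
  addK rB rC (+ 0) ∷
  ifK ge rA (+ 0) 15 13 ∷
  kSub rA rA (+ 0) ∷
  kSub rB rB (+ 0) ∷
  add rA rA rA ∷
  addK rA rA (+ 1) ∷
  const rC (+ 1) ∷
  ifReg le rC rA 19 21 ∷
  add rC rC rC ∷
  goto 18 ∷
  const rD (+ 0) ∷
  add rA rA rA ∷
  ifReg eq rA rC 29 24 ∷
  add rD rD rD ∷
  ifReg gt rA rC 26 22 ∷
  sub rA rA rC ∷
  add rD rD rB ∷
  goto 22 ∷
  write rD ∷
  []

module Multiplier (load₁ load₂ : Instr 4) where

  P : Program 4
  P = multiplier load₁ load₂

  open Execution P public

  at : ℕ → Regs 4 → Config 4
  at ℓ ρ = config ℓ ρ [] []

  -- Invariant of the loop at line 22.  A = (2c+1)·X and C = 2^(m+1)·X, so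
  -- the bits of A below those of C are the m bits of c followed by the
  -- sentinel 1; D holds the number r formed by the bits already read.
  Reading : ℤ → ℕ → ℕ → ℕ → ℤ → Regs 4 → Set
  Reading b m X c r ρ =
    ρ rA ≡ + ((1 + 2 * c) * X) × ρ rB ≡ b × ρ rC ≡ + (2 ^ suc m * X) × ρ rD ≡ r

  readSentinel : ∀ {b X r ρ} → Reading b 0 X 0 r ρ → HaltsWithin (at 22 ρ) 3 [ r ]
  readSentinel {X = X} {ρ = ρ} (eA , _ , eC , eD) =
    step-then (step refl refl) (step-then (ifReg-taken refl A'≡C eC refl)
      (step-then (step refl refl) (halts refl (cong [_] eD))))
    where
    A'≡C : ρ rA ℤ.+ ρ rA ≡ + (2 ^ 1 * X)
    A'≡C = trans (cong₂ ℤ._+_ eA eA) (cong +_ (twice X))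
      where
      twice : ∀ X → (1 + 2 * 0) * X + (1 + 2 * 0) * X ≡ 2 ^ 1 * X
      twice = ℕ-Ring.solve-∀

  private
    shift : ∀ K X → 2 * K * X ≡ K * (2 * X)
    shift = ℕ-Ring.solve-∀

    double : ∀ a X → a * X + a * X ≡ a * (2 * X)
    double = ℕ-Ring.solve-∀

  readZeroBit : ∀ {b m X c r ρ} .{{_ : ℕ.NonZero X}} → c < 2 ^ m → Reading b (suc m) X c r ρ →
    ∃ λ ρ' → Steps P 4 (at 22 ρ) (at 22 ρ') × Reading b m (2 * X) c (r ℤ.+ r) ρ'
  readZeroBit {m = m} {X} {c} {ρ = ρ} c<M (eA , eB , eC , eD) =
    _ , more (step refl refl) (more (ifReg-skipped refl eA' eC' (ℤₚ.<⇒≢ A'<C))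
          (more (step refl refl) (more (ifReg-skipped refl eA' eC' (ℤₚ.<-asym A'<C)) done)))
      , eA' , eB , eC' , cong₂ ℤ._+_ eD eD
    where
    eA' : ρ rA ℤ.+ ρ rA ≡ + ((1 + 2 * c) * (2 * X))
    eA' = trans (cong₂ ℤ._+_ eA eA) (cong +_ (double (1 + 2 * c) X))
    eC' : ρ rC ≡ + (2 ^ suc m * (2 * X))
    eC' = trans eC (cong +_ (shift (2 ^ suc m) X))
    A'<C : + ((1 + 2 * c) * (2 * X)) ℤ.< + (2 ^ suc m * (2 * X))
    A'<C = ℤ.+<+ (ℕₚ.*-monoˡ-< (2 * X) {{ℕₚ.m*n≢0 2 X}} (m<n⇒1+2m<2n c<M))

  readOneBit : ∀ {b m X c r ρ} .{{_ : ℕ.NonZero X}} → Reading b (suc m) X (2 ^ m + c) r ρ →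
    ∃ λ ρ' → Steps P 7 (at 22 ρ) (at 22 ρ') × Reading b m (2 * X) c (r ℤ.+ r ℤ.+ b) ρ'
  readOneBit {m = m} {X} {c} {ρ = ρ} (eA , eB , eC , eD) =
    _ , more (step refl refl) (more (ifReg-skipped refl eA' eC' (ℤₚ.<⇒≢ C<A' ∘ sym))
          (more (step refl refl) (more (ifReg-taken refl eA' eC' C<A')
            (more (step refl refl) (more (step refl refl) (more (step refl refl) done))))))
      , eA'' , eB , eC' , cong₂ ℤ._+_ (cong₂ ℤ._+_ eD eD) eB
    where
    C' = 2 ^ suc m * (2 * X)
    rest = (1 + 2 * c) * (2 * X)
    eA' : ρ rA ℤ.+ ρ rA ≡ + (C' + rest)
    eA' = trans (cong₂ ℤ._+_ eA eA) (cong +_ (split (2 ^ m) c X))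
      where
      split : ∀ M c X → (1 + 2 * (M + c)) * X + (1 + 2 * (M + c)) * X ≡ 2 * M * (2 * X) + (1 + 2 * c) * (2 * X)
      split = ℕ-Ring.solve-∀
    eC' : ρ rC ≡ + C'
    eC' = trans eC (cong +_ (shift (2 ^ suc m) X))
    C<A' : + C' ℤ.< + (C' + rest)
    C<A' = ℤ.+<+ (ℕₚ.m<m+n C' (ℕ.>-nonZero⁻¹ rest {{ℕₚ.m*n≢0 (1 + 2 * c) (2 * X)}}))
      where instance _ = ℕₚ.m*n≢0 2 X
    eA'' : ρ rA ℤ.+ ρ rA ℤ.- ρ rC ≡ + rest
    eA'' = trans (cong₂ ℤ._-_ eA' eC') (cancel (+ C') (+ rest))
      where
      cancel : ∀ u v → u ℤ.+ v ℤ.- u ≡ v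
      cancel = ℤ-Ring.solve-∀

  readBits : ∀ {b} m X c r ρ .{{_ : ℕ.NonZero X}} → c < 2 ^ m → Reading b m X c r ρ →
    HaltsWithin (at 22 ρ) (3 + m * 7) [ r ℤ.* + 2 ^ m ℤ.+ + c ℤ.* b ]
  readBits {b} zero X zero r ρ _ reading =
    subst (HaltsWithin (at 22 ρ) 3) (cong [_] (r≡r*1+0*b r b)) (readSentinel reading)
    where
    r≡r*1+0*b : ∀ r b → r ≡ r ℤ.* + 1 ℤ.+ + 0 ℤ.* b
    r≡r*1+0*b = ℤ-Ring.solve-∀
  readBits zero X (suc c) r ρ (s≤s ()) _
  readBits {b} (suc m) X c r ρ c<2M reading with leadingBit (2 ^ m) c c<2M
  ... | inj₁ c<M =
    let ρ' , run , reading' = readZeroBit {m = m} {X} c<M reading in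
    HaltsWithin-mono (ℕₚ.m≤n+m (7 + m * 7) 3)
      (subst (HaltsWithin (at 22 ρ) _) (cong [_] (horner-0 r b (2 ^ m) (+ c)))
        (steps-then run (readBits m (2 * X) c (r ℤ.+ r) ρ' {{ℕₚ.m*n≢0 2 X}} c<M reading')))
  ... | inj₂ (c' , refl , c'<M) =
    let ρ' , run , reading' = readOneBit {m = m} {X} reading in
    subst (HaltsWithin (at 22 ρ) _) (cong [_] (horner-1 r b (2 ^ m) (+ c')))
      (steps-then run (readBits m (2 * X) c' (r ℤ.+ r ℤ.+ b) ρ' {{ℕₚ.m*n≢0 2 X}} c'<M reading'))

  startReading : ∀ {b} a k ρ → ρ rA ≡ + (1 + 2 * a) → ρ rB ≡ b → ρ rC ≡ + 2 ^ k →
    1 + 2 * a < 2 ^ k → HaltsWithin (at 18 ρ) (k * 7) [ + a ℤ.* b ]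
  startReading a zero ρ eA eB eC (s≤s ())
  startReading {b} a (suc m) ρ eA eB eC A<C =
    HaltsWithin-mono (ℕₚ.+-monoˡ-≤ (m * 7) (ℕₚ.m≤m+n 5 2))
      (step-then (ifReg-skipped refl eC eA (ℤₚ.<⇒≱ (ℤ.+<+ A<C))) (step-then (step refl refl)
        (subst (HaltsWithin _ _) (cong [_] (ℤₚ.+-identityˡ (+ a ℤ.* b)))
          (readBits m 1 a (+ 0) _ (1+2m<2n⇒m<n A<C) (eA' , eB , eC' , refl)))))
    where
    eA' : ρ rA ≡ + ((1 + 2 * a) * 1)
    eA' = trans eA (cong +_ (sym (ℕₚ.*-identityʳ (1 + 2 * a))))
    eC' : ρ rC ≡ + (2 ^ suc m * 1)
    eC' = trans eC (cong +_ (sym (ℕₚ.*-identityʳ (2 ^ suc m))))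

  findPower : ∀ {b} a j f ρ → ρ rA ≡ + (1 + 2 * a) → ρ rB ≡ b → ρ rC ≡ + 2 ^ j →
    1 + 2 * a < 2 ^ (j + f) → HaltsWithin (at 18 ρ) (j * 7 + f * 10) [ + a ℤ.* b ]
  findPower a j zero ρ eA eB eC A<2^j+0 =
    HaltsWithin-mono (ℕₚ.m≤m+n (j * 7) 0)
      (startReading a j ρ eA eB eC (subst (λ k → 1 + 2 * a < 2 ^ k) (ℕₚ.+-identityʳ j) A<2^j+0))
  findPower {b} a j (suc f) ρ eA eB eC A<2^j+f with 2 ^ j ℕₚ.≤? 1 + 2 * a
  ... | no  C≰A = HaltsWithin-mono (ℕₚ.m≤m+n (j * 7) _) (startReading a j ρ eA eB eC (ℕₚ.≰⇒> C≰A))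
  ... | yes C≤A =
    subst (λ B → HaltsWithin (at 18 ρ) B [ + a ℤ.* b ]) (cost j f)
      (step-then (ifReg-taken refl eC eA (ℤ.+≤+ C≤A)) (step-then (step refl refl) (step-then (step refl refl)
        (findPower a (suc j) f _ eA eB eC' (subst (λ k → 1 + 2 * a < 2 ^ k) (ℕₚ.+-suc j f) A<2^j+f)))))
    where
    eC' : ρ rC ℤ.+ ρ rC ≡ + 2 ^ suc j
    eC' = trans (cong₂ ℤ._+_ eC eC) (cong +_ (cong (λ k → 2 ^ j + k) (sym (ℕₚ.+-identityʳ (2 ^ j)))))
    cost : ∀ j f → 3 + (suc j * 7 + f * 10) ≡ j * 7 + suc f * 10
    cost = ℕ-Ring.solve-∀

  multiplyNatural : ∀ {b} a n ρ → ρ rA ≡ + a → ρ rB ≡ b → a < 2 ^ n →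
    HaltsWithin (at 15 ρ) (13 + n * 10) [ + a ℤ.* b ]
  multiplyNatural a n ρ eA eB a<2^n =
    step-then (step refl refl) (step-then (step refl refl) (step-then (step refl refl)
      (findPower a 0 (suc n) _ eA' eB refl (m<n⇒1+2m<2n a<2^n))))
    where
    eA' : ρ rA ℤ.+ ρ rA ℤ.+ + 1 ≡ + (1 + 2 * a)
    eA' = trans (cong (ℤ._+ + 1) (cong₂ ℤ._+_ eA eA)) (cong +_ (sentinel a))
      where
      sentinel : ∀ a → a + a + 1 ≡ 1 + 2 * a
      sentinel = ℕ-Ring.solve-∀

  multiplyBySmall : ∀ u w n ρ → ρ rA ≡ u → ρ rB ≡ w → ∣ u ∣ < 2 ^ n →
    HaltsWithin (at 12 ρ) (16 + n * 10) [ u ℤ.* w ]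
  multiplyBySmall (+ a) w n ρ eA eB a<2^n =
    HaltsWithin-mono (ℕₚ.m≤n+m (14 + n * 10) 2)
      (step-then (ifK-taken refl eA (ℤ.+≤+ z≤n)) (multiplyNatural a n ρ eA eB a<2^n))
  multiplyBySmall -[1+ a ] w n ρ eA eB a<2^n =
    step-then (ifK-skipped refl eA λ ()) (step-then (step refl refl) (step-then (step refl refl)
      (subst (HaltsWithin _ _) (cong [_] (neg*neg -[1+ a ] w))
        (multiplyNatural (suc a) n _ (cong (λ v → + 0 ℤ.- v) eA) (cong (λ v → + 0 ℤ.- v) eB) a<2^n))))
    where
    neg*neg : ∀ u w → (+ 0 ℤ.- u) ℤ.* (+ 0 ℤ.- w) ≡ u ℤ.* w
    neg*neg = ℤ-Ring.solve-∀

  multiplyAfterAbs : ∀ x y n ρ → ρ rA ≡ x → ρ rB ≡ y → ρ rC ≡ + ∣ x ∣ → ρ rD ≡ + ∣ y ∣ →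
    ∣ x ∣ ⊓ ∣ y ∣ < 2 ^ n → HaltsWithin (at 8 ρ) (20 + n * 10) [ x ℤ.* y ]
  multiplyAfterAbs x y n ρ eA eB eC eD min<2^n with ∣ x ∣ ℕₚ.≤? ∣ y ∣
  ... | yes ∣x∣≤∣y∣ =
    HaltsWithin-mono (ℕₚ.m≤n+m (17 + n * 10) 3)
      (step-then (ifReg-taken refl eC eD (ℤ.+≤+ ∣x∣≤∣y∣))
        (multiplyBySmall x y n ρ eA eB (subst (_< 2 ^ n) (ℕₚ.m≤n⇒m⊓n≡m ∣x∣≤∣y∣) min<2^n)))
  ... | no ∣x∣≰∣y∣ =
    step-then (ifReg-skipped refl eC eD (∣x∣≰∣y∣ ∘ ℤₚ.drop‿+≤+))
      (step-then (step refl refl) (step-then (step refl refl) (step-then (step refl refl)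
        (subst (HaltsWithin _ _) (cong [_] (ℤₚ.*-comm y x))
          (multiplyBySmall y x n _ (trans (cong (ℤ._+ + 0) eB) (ℤₚ.+-identityʳ y)) eA+0+0
            (subst (_< 2 ^ n) (ℕₚ.m≥n⇒m⊓n≡n (ℕₚ.<⇒≤ (ℕₚ.≰⇒> ∣x∣≰∣y∣))) min<2^n))))))
    where
    eA+0+0 : ρ rA ℤ.+ + 0 ℤ.+ + 0 ≡ x
    eA+0+0 = trans (ℤₚ.+-identityʳ _) (trans (ℤₚ.+-identityʳ _) eA)

  multiply : ∀ x y n ρ → ρ rA ≡ x → ρ rB ≡ y → ∣ x ∣ ⊓ ∣ y ∣ < 2 ^ n →
    HaltsWithin (at 2 ρ) (26 + n * 10) [ x ℤ.* y ]
  multiply x y n ρ eA eB min<2^n =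
    step-then (step refl refl) (absolute-value refl refl x _ (trans (ℤₚ.+-identityʳ _) eA) λ ρ₁ e₁C frame₁ →
      step-then (step refl refl) (absolute-value refl refl y _ (trans (ℤₚ.+-identityʳ _) (trans (frame₁ rB (λ ())) eB))
        λ ρ₂ e₂D frame₂ →
          multiplyAfterAbs x y n ρ₂
            (trans (frame₂ rA (λ ())) (trans (frame₁ rA (λ ())) eA))
            (trans (frame₂ rB (λ ())) (trans (frame₁ rB (λ ())) eB))
            (trans (frame₂ rC (λ ())) e₁C) e₂D min<2^n))

theorem4 :
    (Σ (Program 4) λ P → ∃ λ c →
      ∀ (x y : ℤ) (n : ℕ) → IsSize (∣ x ∣ ⊓ ∣ y ∣) n →
        ∃ λ t → t ≤ c * n × RunsTo P (x ∷ y ∷ []) ((x ℤ.* y) ∷ []) t)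
    ×
    (Σ (Program 4) λ P → ∃ λ c →
      ∀ (x : ℤ) → 2 ≤ ∣ x ∣ →
        ∃ λ t → t ≤ c * ⌊log₂ ∣ x ∣ ⌋ × RunsTo P (x ∷ []) ((x ℤ.* x) ∷ []) t)
theorem4 = (Product.P , 38 , product) , (Square.P , 48 , square)
  where
  module Product = Multiplier (read rA) (read rB)
  module Square = Multiplier (read rA) (addK rB rA (+ 0))

  product : ∀ x y n → IsSize (∣ x ∣ ⊓ ∣ y ∣) n →
    ∃ λ t → t ≤ 38 * n × RunsTo Product.P (x ∷ y ∷ []) ((x ℤ.* y) ∷ []) t
  product x y zero      (() , _)
  product x y n@(suc _) (_ , min<2^n , _) =
    HaltsWithin-mono (affine≤linear 10 28 n)
      (step-then (step refl refl) (step-then (step refl refl) (multiply x y n _ refl refl min<2^n)))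
    where open Product

  square : ∀ x → 2 ≤ ∣ x ∣ →
    ∃ λ t → t ≤ 48 * ⌊log₂ ∣ x ∣ ⌋ × RunsTo Square.P (x ∷ []) ((x ℤ.* x) ∷ []) t
  square x 2≤∣x∣ with ⌊log₂ ∣ x ∣ ⌋ | 2≤n⇒1≤⌊log₂n⌋ 2≤∣x∣ | n<2^[1+⌊log₂n⌋] ∣ x ∣
  ... | zero      | () | _
  ... | L@(suc _) | _  | ∣x∣<2^[1+L] =
    HaltsWithin-mono (affine≤linear 10 38 L)
      (step-then (step refl refl) (step-then (step refl refl)
        (multiply x x (suc L) _ refl (ℤₚ.+-identityʳ x) (subst (_< 2 ^ suc L) (sym (ℕₚ.⊓-idem ∣ x ∣)) ∣x∣<2^[1+L]))))
    where open Square
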